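{- Let $s,t\in\mathbb Z$ and $f\in\mathbb Z_{\geq0}$, and let $u=(s-1,f)$, $v=(t-1,0)$. Then \[\sum_{P\in\mathscr P(u,v)}w(P)=e^{[f|s-t-f-1]}_{s-t}(z|\tau^{ -t}b).\] In particular, both sides are zero unless $0\leq s-t\leq f$.
   Context: Let $D$ be the directed graph with vertex set $\mathbb Z\times\mathbb Z_{\geq0}$ and an edge from $u$ to $v$ whenever $u-v=(0,1)$ (vertical edge) or $u-v=(1,1)$ (diagonal edge). With $\mathbf b=(b_i)_{i\in\mathbb Z}$ independent indeterminates, the weight of a vertical edge is $1$ and the weight of a diagonal edge with source $(s',t')$ is $z_{t'}+b_{t'-s'}$. $\mathscr P(u,v)$ is the set of directed paths from $u$ to $v$, and $w(P)$ is the product of the weights of the edges of $P$. $\tau^kb=(b_{1+k},b_{2+k},\dots)$. For integer $k$ and sequence $y$: $e^{[k]}_u(y)=\prod_{i=1}^k(1+y_iu)$ ($k\geq0$), $\prod_{i=1}^{|k|}(1-y_iu)^{ -1}$ ($k\leq0$); $e^{[k|\ell]}_m(z|y)$ is the coefficient of $u^m$ in $e^{[k]}_u(z)e^{[\ell]}_u(y)$ (zero for $m<0$). -}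

module Defs where

open import Level using (Level)
open import Algebra.Bundles using (CommutativeRing)
open import Data.Nat as ℕ using (ℕ; zero; suc; _∸_)
open import Data.Integer as ℤ using (ℤ; +_; -[1+_]; _-_; 1ℤ)
open import Data.List using (List; []; _∷_; _++_; map; foldr)
open import Relation.Nullary using (yes; no)
open import Relation.Binary.PropositionalEquality using (refl)

-- Vertices of D are pairs (x , y) ∈ ℤ × ℤ≥0.
-- Path x y x' y' : directed paths in D from (x , y) to (x' , y').
-- An edge goes from (x , suc y) to (x , y) (vertical) or to (x - 1 , y) (diagonal).
data Path : ℤ → ℕ → ℤ → ℕ → Set where
  stop : ∀ {x y} → Path x y x y
  vert : ∀ {x y x' y'} → Path x y x' y' → Path x (suc y) x' y'
  diag : ∀ {x y x' y'} → Path (x - 1ℤ) y x' y' → Path x (suc y) x' y'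

allPaths : ∀ x y x' y' → List (Path x y x' y')
allPaths x zero x' zero with x ℤ.≟ x'
... | yes refl = stop ∷ []
... | no _ = []
allPaths x zero x' (suc y') = []
allPaths x (suc y) x' y' =
  here ++ (map vert (allPaths x y x' y') ++ map diag (allPaths (x - 1ℤ) y x' y'))
  where
  here : List (Path x (suc y) x' y')
  here with x ℤ.≟ x' | suc y ℕ.≟ y'
  ... | yes refl | yes refl = stop ∷ []
  ... | _ | _ = []

module WithRing {c ℓ : Level} (R : CommutativeRing c ℓ) where
  open CommutativeRing R public using (Carrier; _≈_; 0#; 1#)
  open CommutativeRing R using (_+_; _*_)

  weight : (z : ℕ → Carrier) (b : ℤ → Carrier) → ∀ {x y x' y'} → Path x y x' y' → Carrier
  weight z b stop = 1#
  weight z b (vert p) = weight z b p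
  weight z b (diag {x} {y} p) = (z (suc y) + b (+ suc y - x)) * weight z b p

  sumList : List Carrier → Carrier
  sumList = foldr _+_ 0#

  pathSum : (z : ℕ → Carrier) (b : ℤ → Carrier) → ℤ → ℕ → ℤ → ℕ → Carrier
  pathSum z b x y x' y' = sumList (map (weight z b) (allPaths x y x' y'))

  -- formal power series in u, as coefficient sequences
  Series : Set c
  Series = ℕ → Carrier

  sumTo : ℕ → (ℕ → Carrier) → Carrier
  sumTo zero f = f 0
  sumTo (suc n) f = sumTo n f + f (suc n)

  _⊛_ : Series → Series → Series
  (f ⊛ g) n = sumTo n (λ i → f i * g (n ∸ i))

  oneS : Series
  oneS zero = 1#
  oneS (suc _) = 0#

  linS : Carrier → Series
  linS a zero = 1#
  linS a (suc zero) = a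
  linS a (suc (suc _)) = 0#

  pow : Carrier → ℕ → Carrier
  pow a zero = 1#
  pow a (suc n) = a * pow a n

  -- (1 - a u)^{-1} = ∑ a^n u^n
  geomS : Carrier → Series
  geomS a n = pow a n

  prodS : ℕ → (ℕ → Series) → Series
  prodS zero F = oneS
  prodS (suc k) F = prodS k F ⊛ F (suc k)

  -- e^{[k]}_u(y), y = (y_1, y_2, ...) (y 0 unused)
  eGen : ℤ → (ℕ → Carrier) → Series
  eGen (+ k) y = prodS k (λ i → linS (y i))
  eGen -[1+ k ] y = prodS (suc k) (λ i → geomS (y i))

  coeff : Series → ℤ → Carrier
  coeff f (+ m) = f m
  coeff f -[1+ _ ] = 0#

  eKL : ℤ → ℤ → ℤ → (ℕ → Carrier) → (ℕ → Carrier) → Carrier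
  eKL k l m z y = coeff (eGen k z ⊛ eGen l y) m

τ : ∀ {a} {A : Set a} → ℤ → (ℤ → A) → ℕ → A
τ k b i = b (+ i ℤ.+ k)

module Submission where

-- Splitting off the first edge of a path starting in row f + 1 gives the recurrence
-- P_{f+1}(x) = P_f(x) + (z_{f+1} + b_{f+1-x}) P_f(x-1) for the path sums.  The right-hand side
-- E_f(m), the u^m-coefficient of ∏_{i≤f} (1 + z_i u) / ∏_{i≤f+1-m} (1 - y_i u) with y_i = b_{i-t},
-- obeys the same recurrence with the same initial row: passing from f to f + 1 multiplies the
-- numerator by (1 + z_{f+1} u) and the denominator by (1 - y_{f+2-m} u), and
-- (1 + c u)/(1 - a u) = 1 + (c + a) u/(1 - a u).  Vanishing for m > f is a degree count: there
-- both factors are polynomials, of total degree m - 1.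

open import Defs
open import Level using (Level)
open import Algebra.Bundles using (CommutativeRing)
open import Data.Nat using (ℕ)
open import Data.Integer using (ℤ; +_; _-_; -_; 1ℤ; 0ℤ; _≤_)
open import Data.Product using (_×_)
open import Relation.Nullary using (¬_)

import Algebra.Properties.CommutativeSemigroup as CommutativeSemigroupProperties
open import Data.Nat as ℕ using (zero; suc; _∸_; z≤n; s≤s)
import Data.Nat.Properties as ℕ
open import Data.Integer as ℤ using (-[1+_]; _⊖_)
import Data.Integer.Properties as ℤ
open import Data.Integer.Tactic.RingSolver using (solve-∀)
open import Data.List using (List; []; _∷_; _++_; map)
open import Data.List.Properties using (map-++; map-∘)
open import Data.Product using (_,_)
open import Function using (_∘_)
open import Relation.Nullary using (yes; no)
open import Relation.Nullary.Negation using (contradiction)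
open import Relation.Binary.PropositionalEquality as ≡ using (_≡_)
import Relation.Binary.Reasoning.Setoid as SetoidReasoning

exponent≡⊖ : ∀ n f → + n - + f - 1ℤ ≡ n ⊖ suc f
exponent≡⊖ n f = ≡.trans (sub-sub (+ n) (+ f)) (ℤ.m-n≡m⊖n n (suc f))
  where
  sub-sub : ∀ a e → a - e - 1ℤ ≡ a - (1ℤ ℤ.+ e)
  sub-sub = solve-∀

allPaths-suc : ∀ x f x′ →
  allPaths x (suc f) x′ 0 ≡ map vert (allPaths x f x′ 0) ++ map diag (allPaths (x - 1ℤ) f x′ 0)
allPaths-suc x f x′ with x ℤ.≟ x′
... | yes ≡.refl = ≡.refl
... | no  _      = ≡.refl

module _ {c ℓ : Level} (R : CommutativeRing c ℓ) where
  open WithRing R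
  open CommutativeRing R
    using ( _+_; _*_; setoid; +-cong; +-congˡ; +-congʳ; *-congˡ; *-congʳ
          ; +-assoc; +-comm; *-assoc; distribˡ; distribʳ; zeroˡ; zeroʳ
          ; +-identityˡ; +-identityʳ; *-identityˡ; *-identityʳ
          ; +-commutativeSemigroup; *-commutativeSemigroup
          ; refl; sym; trans; reflexive )
  open CommutativeSemigroupProperties +-commutativeSemigroup using (interchange)
  open CommutativeSemigroupProperties *-commutativeSemigroup using (x∙yz≈y∙xz)
  open SetoidReasoning setoid

  sumTo-cong : ∀ n {f g : ℕ → Carrier} → (∀ {i} → i ℕ.≤ n → f i ≈ g i) → sumTo n f ≈ sumTo n g
  sumTo-cong zero    f≈g = f≈g z≤n
  sumTo-cong (suc n) f≈g = +-cong (sumTo-cong n (f≈g ∘ ℕ.m≤n⇒m≤1+n)) (f≈g ℕ.≤-refl)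

  sumTo-zero : ∀ n {f : ℕ → Carrier} → (∀ {i} → i ℕ.≤ n → f i ≈ 0#) → sumTo n f ≈ 0#
  sumTo-zero zero    f≈0 = f≈0 z≤n
  sumTo-zero (suc n) f≈0 =
    trans (+-cong (sumTo-zero n (f≈0 ∘ ℕ.m≤n⇒m≤1+n)) (f≈0 ℕ.≤-refl)) (+-identityʳ 0#)

  sumTo-distrib-+ : ∀ n (f g : ℕ → Carrier) → sumTo n (λ i → f i + g i) ≈ sumTo n f + sumTo n g
  sumTo-distrib-+ zero    f g = refl
  sumTo-distrib-+ (suc n) f g = trans (+-congʳ (sumTo-distrib-+ n f g)) (interchange _ _ _ _)

  *-distribˡ-sumTo : ∀ n a (f : ℕ → Carrier) → a * sumTo n f ≈ sumTo n (λ i → a * f i)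
  *-distribˡ-sumTo zero    a f = refl
  *-distribˡ-sumTo (suc n) a f = trans (distribˡ a _ _) (+-congʳ (*-distribˡ-sumTo n a f))

  sumTo-suc : ∀ n (f : ℕ → Carrier) → sumTo (suc n) f ≈ f 0 + sumTo n (f ∘ suc)
  sumTo-suc zero    f = refl
  sumTo-suc (suc n) f = trans (+-congʳ (sumTo-suc n f)) (+-assoc _ _ _)

  sumList-++ : ∀ (xs ys : List Carrier) → sumList (xs ++ ys) ≈ sumList xs + sumList ys
  sumList-++ []       ys = sym (+-identityˡ _)
  sumList-++ (x ∷ xs) ys = trans (+-congˡ (sumList-++ xs ys)) (sym (+-assoc _ _ _))

  *-distribˡ-sumList : ∀ a (xs : List Carrier) → a * sumList xs ≈ sumList (map (a *_) xs)
  *-distribˡ-sumList a []       = zeroʳ a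
  *-distribˡ-sumList a (x ∷ xs) = trans (distribˡ a _ _) (+-congˡ (*-distribˡ-sumList a xs))

  ⊛-congˡ : ∀ {F F′ G : Series} → (∀ i → F i ≈ F′ i) → ∀ n → (F ⊛ G) n ≈ (F′ ⊛ G) n
  ⊛-congˡ F≈F′ n = sumTo-cong n (λ {i} _ → *-congʳ (F≈F′ i))

  ⊛-congʳ : ∀ {F G G′ : Series} → (∀ i → G i ≈ G′ i) → ∀ n → (F ⊛ G) n ≈ (F ⊛ G′) n
  ⊛-congʳ G≈G′ n = sumTo-cong n (λ {i} _ → *-congˡ (G≈G′ (n ∸ i)))

  ⊛-distribʳ-+ : ∀ (F F′ G : Series) n → ((λ k → F k + F′ k) ⊛ G) n ≈ (F ⊛ G) n + (F′ ⊛ G) n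
  ⊛-distribʳ-+ F F′ G n = trans (sumTo-cong n (λ _ → distribʳ _ _ _)) (sumTo-distrib-+ n _ _)

  ⊛-distribˡ-+ : ∀ (F G G′ : Series) n → (F ⊛ (λ k → G k + G′ k)) n ≈ (F ⊛ G) n + (F ⊛ G′) n
  ⊛-distribˡ-+ F G G′ n = trans (sumTo-cong n (λ _ → distribˡ _ _ _)) (sumTo-distrib-+ n _ _)

  ⊛-scaleˡ : ∀ a (F G : Series) n → ((λ k → a * F k) ⊛ G) n ≈ a * (F ⊛ G) n
  ⊛-scaleˡ a F G n = trans (sumTo-cong n (λ _ → *-assoc _ _ _)) (sym (*-distribˡ-sumTo n a _))

  ⊛-scaleʳ : ∀ a (F G : Series) n → (F ⊛ (λ k → a * G k)) n ≈ a * (F ⊛ G) n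
  ⊛-scaleʳ a F G n = trans (sumTo-cong n (λ _ → x∙yz≈y∙xz _ _ _)) (sym (*-distribˡ-sumTo n a _))

  ⊛-sucʳ : ∀ (F G : Series) n → (F ⊛ G) (suc n) ≈ (F ⊛ (G ∘ suc)) n + F (suc n) * G 0
  ⊛-sucʳ F G n = +-cong (sumTo-cong n (λ i≤n → *-congˡ (reflexive (≡.cong G (ℕ.+-∸-assoc 1 i≤n)))))
                        (*-congˡ (reflexive (≡.cong G (ℕ.n∸n≡0 n))))

  ⊛-identityʳ : ∀ (F : Series) n → (F ⊛ oneS) n ≈ F n
  ⊛-identityʳ F zero    = *-identityʳ _
  ⊛-identityʳ F (suc n) = begin
    (F ⊛ oneS) (suc n)                  ≈⟨ ⊛-sucʳ F oneS n ⟩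
    (F ⊛ (λ _ → 0#)) n + F (suc n) * 1# ≈⟨ +-cong (sumTo-zero n (λ _ → zeroʳ _)) (*-identityʳ _) ⟩
    0# + F (suc n)                      ≈⟨ +-identityˡ _ ⟩
    F (suc n)                           ∎

  shiftS : Series → Series
  shiftS F zero    = 0#
  shiftS F (suc n) = F n

  shiftS-⊛ : ∀ (F G : Series) n → (shiftS F ⊛ G) n ≈ shiftS (F ⊛ G) n
  shiftS-⊛ F G zero    = zeroˡ _
  shiftS-⊛ F G (suc n) = trans (sumTo-suc n _) (trans (+-congʳ (zeroˡ _)) (+-identityˡ _))

  ⊛-shiftS : ∀ (F G : Series) n → (F ⊛ shiftS G) n ≈ shiftS (F ⊛ G) n
  ⊛-shiftS F G zero    = zeroʳ _
  ⊛-shiftS F G (suc n) = trans (⊛-sucʳ F (shiftS G) n) (trans (+-congˡ (zeroʳ _)) (+-identityʳ _))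

  ⊛-linS : ∀ (F : Series) a n → (F ⊛ linS a) n ≈ F n + a * shiftS F n
  ⊛-linS F a zero    = trans (*-identityʳ _) (sym (trans (+-congˡ (zeroʳ a)) (+-identityʳ _)))
  ⊛-linS F a (suc n) = begin
    (F ⊛ linS a) (suc n)                     ≈⟨ ⊛-sucʳ F (linS a) n ⟩
    (F ⊛ (linS a ∘ suc)) n + F (suc n) * 1#  ≈⟨ +-cong (⊛-congʳ linS-tail n) (*-identityʳ _) ⟩
    (F ⊛ (λ k → a * oneS k)) n + F (suc n)   ≈⟨ +-congʳ (⊛-scaleʳ a F oneS n) ⟩
    a * (F ⊛ oneS) n + F (suc n)             ≈⟨ +-congʳ (*-congˡ (⊛-identityʳ F n)) ⟩
    a * F n + F (suc n)                      ≈⟨ +-comm _ _ ⟩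
    F (suc n) + a * F n                      ∎
    where
    linS-tail : ∀ k → linS a (suc k) ≈ a * oneS k
    linS-tail zero    = sym (*-identityʳ a)
    linS-tail (suc k) = sym (zeroʳ a)

  ⊛-geomS : ∀ (F : Series) a n → (F ⊛ geomS a) n ≈ F n + a * shiftS (F ⊛ geomS a) n
  ⊛-geomS F a zero    = trans (*-identityʳ _) (sym (trans (+-congˡ (zeroʳ a)) (+-identityʳ _)))
  ⊛-geomS F a (suc n) = begin
    (F ⊛ geomS a) (suc n)                          ≈⟨ ⊛-sucʳ F (geomS a) n ⟩
    (F ⊛ (λ k → a * geomS a k)) n + F (suc n) * 1# ≈⟨ +-cong (⊛-scaleʳ a F (geomS a) n) (*-identityʳ _) ⟩
    a * (F ⊛ geomS a) n + F (suc n)                ≈⟨ +-comm _ _ ⟩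
    F (suc n) + a * (F ⊛ geomS a) n                ∎

  ⊛-shiftedˡ : ∀ (F F₁ F₂ G : Series) a → (∀ k → F k ≈ F₁ k + a * shiftS F₂ k) →
               ∀ n → (F ⊛ G) n ≈ (F₁ ⊛ G) n + a * shiftS (F₂ ⊛ G) n
  ⊛-shiftedˡ F F₁ F₂ G a F≈ n = begin
    (F ⊛ G) n                                     ≈⟨ ⊛-congˡ {G = G} F≈ n ⟩
    ((λ k → F₁ k + a * shiftS F₂ k) ⊛ G) n        ≈⟨ ⊛-distribʳ-+ F₁ _ G n ⟩
    (F₁ ⊛ G) n + ((λ k → a * shiftS F₂ k) ⊛ G) n  ≈⟨ +-congˡ (⊛-scaleˡ a (shiftS F₂) G n) ⟩
    (F₁ ⊛ G) n + a * (shiftS F₂ ⊛ G) n            ≈⟨ +-congˡ (*-congˡ (shiftS-⊛ F₂ G n)) ⟩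
    (F₁ ⊛ G) n + a * shiftS (F₂ ⊛ G) n            ∎

  ⊛-shiftedʳ : ∀ (F G G₁ G₂ : Series) a → (∀ k → G k ≈ G₁ k + a * shiftS G₂ k) →
               ∀ n → (F ⊛ G) n ≈ (F ⊛ G₁) n + a * shiftS (F ⊛ G₂) n
  ⊛-shiftedʳ F G G₁ G₂ a G≈ n = begin
    (F ⊛ G) n                                     ≈⟨ ⊛-congʳ {F} G≈ n ⟩
    (F ⊛ (λ k → G₁ k + a * shiftS G₂ k)) n        ≈⟨ ⊛-distribˡ-+ F G₁ (λ k → a * shiftS G₂ k) n ⟩
    (F ⊛ G₁) n + (F ⊛ (λ k → a * shiftS G₂ k)) n  ≈⟨ +-congˡ (⊛-scaleʳ a F (shiftS G₂) n) ⟩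
    (F ⊛ G₁) n + a * (F ⊛ shiftS G₂) n            ≈⟨ +-congˡ (*-congˡ (⊛-shiftS F G₂ n)) ⟩
    (F ⊛ G₁) n + a * shiftS (F ⊛ G₂) n            ∎

  linS-⊛-geomS : ∀ (A Y : Series) c a n →
    ((A ⊛ linS c) ⊛ (Y ⊛ geomS a)) n ≈ (A ⊛ Y) n + (c + a) * shiftS (A ⊛ (Y ⊛ geomS a)) n
  linS-⊛-geomS A Y c a n = begin
    ((A ⊛ linS c) ⊛ W) n              ≈⟨ ⊛-shiftedˡ (A ⊛ linS c) A A W c (⊛-linS A c) n ⟩
    (A ⊛ W) n + c * X                 ≈⟨ +-congʳ (⊛-shiftedʳ A W Y W a (⊛-geomS Y a) n) ⟩
    ((A ⊛ Y) n + a * X) + c * X       ≈⟨ +-assoc _ _ _ ⟩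
    (A ⊛ Y) n + (a * X + c * X)       ≈⟨ +-congˡ (sym (distribʳ X a c)) ⟩
    (A ⊛ Y) n + (a + c) * X           ≈⟨ +-congˡ (*-congʳ (+-comm a c)) ⟩
    (A ⊛ Y) n + (c + a) * X           ∎
    where
    W : Series
    W = Y ⊛ geomS a
    X : Carrier
    X = shiftS (A ⊛ W) n

  DegreeBelow : ℕ → Series → Set ℓ
  DegreeBelow d F = ∀ {n} → d ℕ.≤ n → F n ≈ 0#

  prodS-linS-degreeBelow : ∀ k (y : ℕ → Carrier) → DegreeBelow (suc k) (prodS k (linS ∘ y))
  prodS-linS-degreeBelow zero    y {suc n} _ = refl
  prodS-linS-degreeBelow (suc k) y {suc n} (s≤s k<n) = begin
    (F ⊛ linS (y (suc k))) (suc n)   ≈⟨ ⊛-linS F (y (suc k)) (suc n) ⟩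
    F (suc n) + y (suc k) * F n      ≈⟨ +-cong (F<k (ℕ.m≤n⇒m≤1+n k<n)) (*-congˡ (F<k k<n)) ⟩
    0# + y (suc k) * 0#              ≈⟨ trans (+-identityˡ _) (zeroʳ _) ⟩
    0#                               ∎
    where
    F : Series
    F = prodS k (linS ∘ y)
    F<k : DegreeBelow (suc k) F
    F<k = prodS-linS-degreeBelow k y

  ⊛-degreeBelow : ∀ {F G : Series} p q → DegreeBelow (suc p) F → DegreeBelow (suc q) G →
                  DegreeBelow (suc (p ℕ.+ q)) (F ⊛ G)
  ⊛-degreeBelow {F} {G} p q F<p G<q {n} p+q<n = sumTo-zero n term-zero
    where
    term-zero : ∀ {i} → i ℕ.≤ n → F i * G (n ∸ i) ≈ 0#
    term-zero {i} i≤n with i ℕ.≤? p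
    ... | no  i≰p = trans (*-congʳ (F<p (ℕ.≰⇒> i≰p))) (zeroˡ _)
    ... | yes i≤p = trans (*-congˡ (G<q q<n∸i)) (zeroʳ _)
      where
      q<n∸i : suc q ℕ.≤ n ∸ i
      q<n∸i = ≡.subst (ℕ._≤ n ∸ i) (ℕ.m+n∸m≡n i (suc q))
        (ℕ.∸-monoˡ-≤ i (ℕ.≤-trans (ℕ.+-monoˡ-≤ (suc q) i≤p)
                                   (ℕ.≤-trans (ℕ.≤-reflexive (ℕ.+-suc p q)) p+q<n)))

  eGen-neg : ∀ k (y : ℕ → Carrier) → eGen (- + k) y ≡ prodS k (geomS ∘ y)
  eGen-neg zero    y = ≡.refl
  eGen-neg (suc k) y = ≡.refl

  eGen-geometric : ∀ n f (y : ℕ → Carrier) → n ℕ.≤ suc f →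
                   eGen (+ n - + f - 1ℤ) y ≡ prodS (suc f ∸ n) (geomS ∘ y)
  eGen-geometric n f y n≤1+f = ≡.trans (≡.cong (λ e → eGen e y) (≡.trans (exponent≡⊖ n f) (ℤ.⊖-≤ n≤1+f)))
                                       (eGen-neg (suc f ∸ n) y)

  eGen-polynomial : ∀ n f (y : ℕ → Carrier) → f ℕ.< n →
                    eGen (+ n - + f - 1ℤ) y ≡ prodS (n ∸ suc f) (linS ∘ y)
  eGen-polynomial n f y f<n = ≡.cong (λ e → eGen e y) (≡.trans (exponent≡⊖ n f) (ℤ.⊖-≥ f<n))

  module _ (z y : ℕ → Carrier) where

    E : ℕ → ℤ → Carrier
    E f m = eKL (+ f) (m - + f - 1ℤ) m z y

    E-initial : E 0 0ℤ ≈ 1#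
    E-initial = trans (*-identityˡ _) (*-identityˡ 1#)

    E-geometric : ∀ f n → n ℕ.≤ suc f → E f (+ n) ≡ (eGen (+ f) z ⊛ prodS (suc f ∸ n) (geomS ∘ y)) n
    E-geometric f n n≤1+f = ≡.cong (λ Y → (eGen (+ f) z ⊛ Y) n) (eGen-geometric n f y n≤1+f)

    E-vanishes-above : ∀ f n → f ℕ.< n → E f (+ n) ≈ 0#
    E-vanishes-above f n f<n =
      trans (reflexive (≡.cong (λ Y → (eGen (+ f) z ⊛ Y) n) (eGen-polynomial n f y f<n)))
            (⊛-degreeBelow f (n ∸ suc f) (prodS-linS-degreeBelow f z) (prodS-linS-degreeBelow _ y)
                           (ℕ.≤-reflexive (ℕ.m+[n∸m]≡n f<n)))

    E-vanishes : ∀ f m → ¬ (0ℤ ≤ m × m ≤ + f) → E f m ≈ 0#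
    E-vanishes f -[1+ k ] _ = refl
    E-vanishes f (+ n) out with n ℕ.≤? f
    ... | yes n≤f = contradiction (ℤ.+≤+ z≤n , ℤ.+≤+ n≤f) out
    ... | no  n≰f = E-vanishes-above f n (ℕ.≰⇒> n≰f)

    E-pred : ∀ f n → n ℕ.≤ suc f →
             E f (+ n - 1ℤ) ≡ shiftS (eGen (+ f) z ⊛ prodS (suc (suc f ∸ n)) (geomS ∘ y)) n
    E-pred f zero     _          = ≡.refl
    E-pred f (suc n) (s≤s n≤f) =
      ≡.trans (E-geometric f n (ℕ.m≤n⇒m≤1+n n≤f))
              (≡.cong (λ k → (eGen (+ f) z ⊛ prodS k (geomS ∘ y)) n) (ℕ.+-∸-assoc 1 n≤f))

    E-suc-≤ : ∀ f n → n ℕ.≤ suc f →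
              E (suc f) (+ n) ≈ E f (+ n) + (z (suc f) + y (suc (suc f ∸ n))) * E f (+ n - 1ℤ)
    E-suc-≤ f n n≤1+f = begin
      E (suc f) (+ n)
        ≡⟨ E-geometric (suc f) n (ℕ.m≤n⇒m≤1+n n≤1+f) ⟩
      (A ⊛ prodS (suc (suc f) ∸ n) G) n
        ≡⟨ ≡.cong (λ k → (A ⊛ prodS k G) n) (ℕ.+-∸-assoc 1 n≤1+f) ⟩
      ((eGen (+ f) z ⊛ linS z₊) ⊛ (prodS j G ⊛ geomS y₊)) n
        ≈⟨ linS-⊛-geomS (eGen (+ f) z) (prodS j G) z₊ y₊ n ⟩
      (eGen (+ f) z ⊛ prodS j G) n + (z₊ + y₊) * shiftS (eGen (+ f) z ⊛ prodS (suc j) G) n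
        ≡⟨ ≡.cong₂ (λ u v → u + (z₊ + y₊) * v)
                   (≡.sym (E-geometric f n n≤1+f)) (≡.sym (E-pred f n n≤1+f)) ⟩
      E f (+ n) + (z₊ + y₊) * E f (+ n - 1ℤ) ∎
      where
      A : Series
      A = eGen (+ suc f) z
      G : ℕ → Series
      G = geomS ∘ y
      j : ℕ
      j = suc f ∸ n
      z₊ y₊ : Carrier
      z₊ = z (suc f)
      y₊ = y (suc j)

  module _ (z : ℕ → Carrier) (b : ℤ → Carrier) where

    pathSum-suc : ∀ x f x′ → pathSum z b x (suc f) x′ 0 ≈
                  pathSum z b x f x′ 0 + (z (suc f) + b (+ suc f - x)) * pathSum z b (x - 1ℤ) f x′ 0
    pathSum-suc x f x′ = begin
      sumList (map W (allPaths x (suc f) x′ 0))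
        ≡⟨ ≡.cong (sumList ∘ map W) (allPaths-suc x f x′) ⟩
      sumList (map W (map vert ps ++ map (diag {x}) qs))
        ≡⟨ ≡.cong sumList (map-++ W (map vert ps) (map (diag {x}) qs)) ⟩
      sumList (map W (map vert ps) ++ map W (map (diag {x}) qs))
        ≈⟨ sumList-++ (map W (map vert ps)) (map W (map (diag {x}) qs)) ⟩
      sumList (map W (map vert ps)) + sumList (map W (map (diag {x}) qs))
        ≡⟨ ≡.cong₂ (λ u v → sumList u + sumList v)
                   (≡.sym (map-∘ {g = W} {f = vert} ps)) (≡.sym (map-∘ {g = W} {f = diag {x}} qs)) ⟩
      sumList (map W ps) + sumList (map ((w *_) ∘ W) qs)
        ≡⟨ ≡.cong (λ v → sumList (map W ps) + sumList v) (map-∘ {g = w *_} {f = W} qs) ⟩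
      sumList (map W ps) + sumList (map (w *_) (map W qs))
        ≈⟨ +-congˡ (sym (*-distribˡ-sumList w (map W qs))) ⟩
      sumList (map W ps) + w * sumList (map W qs) ∎
      where
      W : ∀ {x y x′ y′} → Path x y x′ y′ → Carrier
      W = weight z b
      w : Carrier
      w = z (suc f) + b (+ suc f - x)
      ps : List (Path x f x′ 0)
      ps = allPaths x f x′ 0
      qs : List (Path (x - 1ℤ) f x′ 0)
      qs = allPaths (x - 1ℤ) f x′ 0

    module _ (t : ℤ) where

      y : ℕ → Carrier
      y = τ (- t) b

      E-suc : ∀ f m → E z y (suc f) m ≈
              E z y f m + (z (suc f) + b (+ suc (suc f) - m - t)) * E z y f (m - 1ℤ)
      E-suc f -[1+ k ] = sym (trans (+-congˡ (zeroʳ _)) (+-identityʳ 0#))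
      E-suc f (+ n) with n ℕ.≤? suc f
      ... | yes n≤1+f =
        trans (E-suc-≤ z y f n n≤1+f) (+-congˡ (*-congʳ (+-congˡ (reflexive (≡.cong b index)))))
        where
        index : + suc (suc f ∸ n) ℤ.+ - t ≡ + suc (suc f) - + n - t
        index = ≡.cong (_- t) (≡.sym (≡.trans (ℤ.m-n≡m⊖n (suc (suc f)) n)
                  (≡.trans (ℤ.⊖-≥ (ℕ.m≤n⇒m≤1+n n≤1+f)) (≡.cong +_ (ℕ.+-∸-assoc 1 n≤1+f)))))
      E-suc f (+ zero)  | no 0≰1+f = contradiction z≤n 0≰1+f
      E-suc f (+ suc n) | no n≰1+f = begin
        E z y (suc f) (+ suc n)  ≈⟨ E-vanishes-above z y (suc f) (suc n) 1+f<1+n ⟩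
        0#                       ≈⟨ sym (trans (+-congˡ (zeroʳ _)) (+-identityʳ 0#)) ⟩
        0# + _ * 0#              ≈⟨ sym (+-cong (E-vanishes-above z y f (suc n) (ℕ.m<n⇒m<1+n f<n))
                                                (*-congˡ (E-vanishes-above z y f n f<n))) ⟩
        E z y f (+ suc n) + _ * E z y f (+ n) ∎
        where
        1+f<1+n : suc f ℕ.< suc n
        1+f<1+n = ℕ.≰⇒> n≰1+f
        f<n : f ℕ.< n
        f<n = ℕ.≤-pred 1+f<1+n

      pathSum≈E : ∀ f x → pathSum z b x f (t - 1ℤ) 0 ≈ E z y f (x - (t - 1ℤ))
      pathSum≈E zero x with x ℤ.≟ t - 1ℤ
      ... | yes ≡.refl = trans (+-identityʳ 1#)
                           (trans (sym (E-initial z y)) (reflexive (≡.cong (E z y 0) (≡.sym (ℤ.+-inverseʳ x)))))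
      ... | no  x≢x′ = sym (E-vanishes z y 0 (x - (t - 1ℤ)) (λ (0≤ , ≤0) →
                         x≢x′ (ℤ.i-j≡0⇒i≡j x (t - 1ℤ) (ℤ.≤-antisym ≤0 0≤))))
      pathSum≈E (suc f) x = begin
        pathSum z b x (suc f) x′ 0
          ≈⟨ pathSum-suc x f x′ ⟩
        pathSum z b x f x′ 0 + w * pathSum z b (x - 1ℤ) f x′ 0
          ≈⟨ +-cong (pathSum≈E f x) (*-congˡ (pathSum≈E f (x - 1ℤ))) ⟩
        E z y f (x - x′) + w * E z y f (x - 1ℤ - x′)
          ≡⟨ ≡.cong₂ (λ i m → E z y f (x - x′) + (z (suc f) + b i) * E z y f m)
                     (≡.sym (weight-index (+ suc f) x t)) (pred-sub x x′) ⟩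
        E z y f (x - x′) + (z (suc f) + b (1ℤ ℤ.+ + suc f - (x - x′) - t)) * E z y f (x - x′ - 1ℤ)
          ≈⟨ sym (E-suc f (x - x′)) ⟩
        E z y (suc f) (x - x′) ∎
        where
        x′ : ℤ
        x′ = t - 1ℤ
        w : Carrier
        w = z (suc f) + b (+ suc f - x)
        weight-index : ∀ a x t → 1ℤ ℤ.+ a - (x - (t - 1ℤ)) - t ≡ a - x
        weight-index = solve-∀
        pred-sub : ∀ x x′ → x - 1ℤ - x′ ≡ x - x′ - 1ℤ
        pred-sub = solve-∀

      pathSum≈E[s-t] : ∀ s f → pathSum z b (s - 1ℤ) f (t - 1ℤ) 0 ≈ E z y f (s - t)
      pathSum≈E[s-t] s f = trans (pathSum≈E f (s - 1ℤ)) (reflexive (≡.cong (E z y f) (sub-pred s t)))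
        where
        sub-pred : ∀ s t → s - 1ℤ - (t - 1ℤ) ≡ s - t
        sub-pred = solve-∀

lemma6p2 : ∀ {c ℓ : Level} (R : CommutativeRing c ℓ) →
    let open WithRing R in
    (z : ℕ → Carrier) (b : ℤ → Carrier) (s t : ℤ) (f : ℕ) →
    (pathSum z b (s - 1ℤ) f (t - 1ℤ) 0 ≈ eKL (+ f) (s - t - + f - 1ℤ) (s - t) z (τ (- t) b))
    × (¬ (0ℤ ≤ s - t × s - t ≤ + f) →
    (pathSum z b (s - 1ℤ) f (t - 1ℤ) 0 ≈ 0#)
    × (eKL (+ f) (s - t - + f - 1ℤ) (s - t) z (τ (- t) b) ≈ 0#))
lemma6p2 R z b s t f =
  pathSum≈E[s-t] R z b t s f ,
  λ out → CommutativeRing.trans R (pathSum≈E[s-t] R z b t s f) (E-vanishes R z (τ (- t) b) f (s - t) out) ,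
          E-vanishes R z (τ (- t) b) f (s - t) out
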